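{- Let $G=(V,E)$ be a connected graph with root $r\in V$, vertex probabilities $p_v\in[0,1]$ with $p_r=0$ and $\sum_{v\in V}p_v=1$, positive edge lengths $\lambda_e>0$, and $n=|V\setminus\{r\}|$. For every $\varepsilon>0$, the tree $T^{\mathrm s}$ returned by the parametric search (defined below) with parameter $\varepsilon$ satisfies $$\rho^\star\le (1+\varepsilon)\left(2-\tfrac1n\right)\rho(T^{\mathrm s}),$$ where $\rho^\star$ is the maximum density of a subtree of $G$ containing $r$.
   Context: For $V'\subseteq V$ and $E'\subseteq E$ write $p(V')=\sum_{v\in V'}p_v$ and $\lambda(E')=\sum_{e\in E'}\lambda_e$. Let $\mathcal T(G)$ be the set of subtrees of $G$ containing the root $r$; for $T\in\mathcal T(G)$ write $V[T],E[T]$ for its vertex and edge sets, $p(T)=p(V[T])$, $\lambda(T)=\lambda(E[T])$, and, if $\lambda(T)>0$, its (search) density $\rho(T)=p(T)/\lambda(T)$. The maximum density is $\rho^\star=\max_{T\in\mathcal T(G)}\rho(T)$ (over trees with at least one edge). The prize-collecting Steiner tree (PCST) problem with edge lengths $(\ell_e)$ and vertex penalties $(\pi_v)$ asks for $T\in\mathcal T(G)$ minimizing $\ell(T)+\pi(V\setminus V[T])$. The GW algorithm (Goemans–Williamson) for PCST is known to return a tree $T\in\mathcal T(G)$ with $\ell(T)+(2-\frac1n)\pi(V\setminus V[T])\le(2-\frac1n)(\ell(T')+\pi(V\setminus V[T']))$ for all $T'\in\mathcal T(G)$. Parametric search with parameter $\varepsilon>0$: (1) take an arbitrary $T^{\mathrm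 s}\in\mathcal T(G)$ with $\lambda(T^{\mathrm s})>0$, set $\alpha\gets(2-\frac1n)p(T^{\mathrm s})/\lambda(T^{\mathrm s})$ and $\beta\gets\max\{p_v/\lambda_{\{v,w\}}:\{v,w\}\in E\}$; (2) while $\beta>(1+\varepsilon)\alpha$: set $\rho\gets(\alpha+\beta)/2$; let $T$ be the tree returned by the GW algorithm on $G$ with lengths $(\rho\lambda_e)_{e\in E}$ and penalties $(p_v)_{v\in V}$; if $(2-\frac1n)p(T)\le\rho\lambda(T)$ set $\beta\gets\rho$, otherwise set $\alpha\gets(2-\frac1n)\rho(T)$ and $T^{\mathrm s}\gets T$; (3) return $T^{\mathrm s}$.
   Formalization: The vertex probabilities $p_v$, the edge lengths $\lambda_e$ and the parameter ε are rational numbers rather than reals. -}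

module Defs where

open import Data.Nat as ℕ using (ℕ; zero; suc)
open import Data.Integer using (+_)
open import Data.Fin using (Fin)
open import Data.Fin.Subset using (Subset; Side; inside; outside; _∈_; ∣_∣)
open import Data.Vec using (lookup)
open import Data.List using (List; foldr; allFin)
open import Data.Product using (_×_; Σ-syntax)
open import Data.Sum using (_⊎_)
open import Relation.Binary.PropositionalEquality using (_≡_; _≢_)
open import Relation.Nullary using (yes; no)
open import Data.Rational
  using (ℚ; 0ℚ; 1ℚ; _+_; _*_; _-_; _≤_; _<_; _÷_; _⊔_; _≟_; ≢-nonZero; _/_)

-- total division: a ÷' b = a / b when b ≠ 0, and 0 otherwise
-- (only ever used with b ≠ 0 in the statement)
_÷'_ : ℚ → ℚ → ℚ
a ÷' b with b ≟ 0ℚ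
... | yes _  = 0ℚ
... | no b≢0 = _÷_ a b {{≢-nonZero b≢0}}

infixl 7 _÷'_

ℕtoℚ : ℕ → ℚ
ℕtoℚ k = (+ k) / 1

cfac : ℕ → ℚ
cfac n = (1ℚ + 1ℚ) - (1ℚ ÷' ℕtoℚ n)

Σℚ : ∀ {k} → (Fin k → ℚ) → ℚ
Σℚ {zero}  f = 0ℚ
Σℚ {suc k} f = f Fin.zero + Σℚ (λ i → f (Fin.suc i))

sel : Side → ℚ → ℚ
sel inside  q = q
sel outside q = 0ℚ

selOut : Side → ℚ → ℚ
selOut inside  q = 0ℚ
selOut outside q = q

record Graph (N : ℕ) : Set where
  field
    m      : ℕ
    src    : Fin m → Fin N
    tgt    : Fin m → Fin N
    noLoop : ∀ e → src e ≢ tgt e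
    simple : ∀ e f →
             ((src e ≡ src f × tgt e ≡ tgt f) ⊎ (src e ≡ tgt f × tgt e ≡ src f)) →
             e ≡ f
open Graph public

data Reach {N} (G : Graph N) (S : Subset (m G)) (u : Fin N) : Fin N → Set where
  here  : Reach G S u u
  fwd   : (e : Fin (m G)) → e ∈ S → Reach G S u (src G e) → Reach G S u (tgt G e)
  bwd   : (e : Fin (m G)) → e ∈ S → Reach G S u (tgt G e) → Reach G S u (src G e)

allEdges : ∀ {N} (G : Graph N) → Subset (m G)
allEdges G = Data.Fin.Subset.⊤

Connected : ∀ {N} → Graph N → Set
Connected {N} G = (u v : Fin N) → Reach G (allEdges G) u v

record Tree {N} (G : Graph N) (r : Fin N) : Set where
  field
    VT     : Subset N
    ET     : Subset (m G)
    root∈  : r ∈ VT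
    closed : ∀ e → e ∈ ET → (src G e ∈ VT × tgt G e ∈ VT)
    conn   : ∀ v → v ∈ VT → Reach G ET r v
    count  : ∣ ET ∣ ℕ.+ 1 ≡ ∣ VT ∣
open Tree public

module _ {N} {G : Graph N} {r : Fin N} where

  pT : (Fin N → ℚ) → Tree G r → ℚ
  pT p T = Σℚ (λ v → sel (lookup (VT T) v) (p v))

  πOut : (Fin N → ℚ) → Tree G r → ℚ
  πOut π T = Σℚ (λ v → selOut (lookup (VT T) v) (π v))

  ℓT : (Fin (m G) → ℚ) → Tree G r → ℚ
  ℓT ℓ T = Σℚ (λ e → sel (lookup (ET T) e) (ℓ e))

  -- density ρ(T) = p(T)/λ(T)  (used only when λ(T) > 0)
  dens : (Fin N → ℚ) → (Fin (m G) → ℚ) → Tree G r → ℚ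
  dens p len T = pT p T ÷' ℓT len T

-- The (only) property of the GW algorithm used: for every PCST instance
-- with nonnegative lengths ℓ and penalties π, the returned tree T satisfies
-- ℓ(T) + (2-1/n) π(V∖V[T]) ≤ (2-1/n) (ℓ(T') + π(V∖V[T'])) for all T'.
IsGW : ∀ {N} (G : Graph N) (r : Fin N) (n : ℕ) →
       ((Fin (m G) → ℚ) → (Fin N → ℚ) → Tree G r) → Set
IsGW {N} G r n gw =
  (ℓ : Fin (m G) → ℚ) (π : Fin N → ℚ) →
  (∀ e → 0ℚ ≤ ℓ e) → (∀ v → 0ℚ ≤ π v) →
  (T' : Tree G r) →
  ℓT ℓ (gw ℓ π) + cfac n * πOut π (gw ℓ π) ≤ cfac n * (ℓT ℓ T' + πOut π T')

betaInit : ∀ {N} (G : Graph N) → (Fin N → ℚ) → (Fin (m G) → ℚ) → ℚ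
betaInit G p len =
  foldr (λ e acc → ((p (src G e) ÷' len e) ⊔ (p (tgt G e) ÷' len e)) ⊔ acc)
        0ℚ (allFin (m G))

-- Executions of the while-loop of the parametric search.
-- ParRun ... α β Ts out : starting the loop in state (α, β, T^s),
-- the loop terminates and step (3) returns out.
data ParRun {N} (G : Graph N) (r : Fin N) (n : ℕ)
            (p : Fin N → ℚ) (len : Fin (m G) → ℚ)
            (gw : (Fin (m G) → ℚ) → (Fin N → ℚ) → Tree G r) (ε : ℚ)
            : ℚ → ℚ → Tree G r → Tree G r → Set where
  stop  : ∀ {α β Ts} → β ≤ (1ℚ + ε) * α → ParRun G r n p len gw ε α β Ts Ts
  stepβ : ∀ {α β Ts out} → (1ℚ + ε) * α < β →
          let ρ = (α + β) ÷' (1ℚ + 1ℚ)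
              T = gw (λ e → ρ * len e) p in
          cfac n * pT p T ≤ ρ * ℓT len T →
          ParRun G r n p len gw ε α ρ Ts out →
          ParRun G r n p len gw ε α β Ts out
  stepα : ∀ {α β Ts out} → (1ℚ + ε) * α < β →
          let ρ = (α + β) ÷' (1ℚ + 1ℚ)
              T = gw (λ e → ρ * len e) p in
          ρ * ℓT len T < cfac n * pT p T →
          ParRun G r n p len gw ε (cfac n * dens p len T) β T out →
          ParRun G r n p len gw ε α β Ts out

{-# OPTIONS --safe #-}
module Submission where

-- The search maintains two invariants: α = (2 - 1/n) ρ(T^s), and β bounds the
-- density of every rooted subtree, p(T) ≤ β λ(T).  The initial β is such a bound
-- because the vertices of a rooted tree other than r can be charged injectively
-- to incident tree edges.  When the GW tree T₀ for lengths ρλ satisfies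
-- (2 - 1/n) p(T₀) ≤ ρ λ(T₀), the GW guarantee combined with
-- p(T) + p(V ∖ V[T]) = 1 yields p(T) ≤ ρ λ(T) for every T, so ρ may replace β.
-- On exit β ≤ (1 + ε) α = (1 + ε)(2 - 1/n) ρ(T^s).

open import Defs
open import Algebra.Bundles using (CommutativeMonoid)
open import Data.Bool.Properties using (∨-identityʳ)
open import Data.Fin using (Fin; zero; suc)
open import Data.Fin.Properties using (any?)
open import Data.Fin.Subset
  using (Subset; inside; outside; _∈_; _∉_; _⊆_; _⊂_; _⊃_; _∪_; _∩_; ⁅_⁆; ⊥)
open import Data.Fin.Subset.Induction using (⊃-wellFounded; Acc; acc)
open import Data.Fin.Subset.Properties
  using (_∈?_; ⊥⊆; ∉⊥; drop-∷-⊆; x∈⁅x⁆; x∈⁅y⁆⇒x≡y; p⊆p∪q; q⊆p∪q;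
         x∈p∪q⁻; p∩q⊆p; p∩q⊆q; x∈p∩q⁺; x∈p∩q⁻; ∪-identityˡ; ∪-identityʳ)
open import Data.List using (List; _∷_; foldr; allFin)
open import Data.List.Membership.Propositional using () renaming (_∈_ to _∈ₗ_)
open import Data.List.Membership.Propositional.Properties using (∈-allFin)
open import Data.List.Relation.Unary.Any using (here; there)
open import Data.Nat as ℕ using (ℕ; suc)
open import Data.Product using (_×_; _,_; proj₁; proj₂)
open import Data.Rational
  using (ℚ; 0ℚ; 1ℚ; _+_; _*_; -_; 1/_; _≤_; _<_; _⊔_; _≟_; Positive; positive; nonNegative; mkℚ; *≤*)
open import Data.Rational.Properties
import Data.Integer as ℤ
import Data.Nat.Coprimality as Coprime
open import Data.Sum using (_⊎_; inj₁; inj₂)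
open import Data.Vec using ([]; _∷_; lookup; tabulate; here; there)
open import Data.Vec.Properties using (lookup∘tabulate; []=⇒lookup; lookup⇒[]=)
open import Function using (_∘_)
open import Relation.Binary.PropositionalEquality
open import Relation.Binary.Definitions using (tri<; tri≈; tri>)
open import Relation.Nullary using (Dec; yes; no; ¬?; contradiction)
open import Relation.Nullary.Decidable using (_×-dec_; _⊎-dec_; decidable-stable)
open import Algebra.Properties.CommutativeSemigroup
  (CommutativeMonoid.commutativeSemigroup +-0-commutativeMonoid) using (interchange)

+-cancelʳ-≤ : ∀ {a b} c → a + c ≤ b + c → a ≤ b
+-cancelʳ-≤ {a} {b} c a+c≤b+c = subst₂ _≤_ (x+c-c≡x a) (x+c-c≡x b) (+-monoˡ-≤ (- c) a+c≤b+c)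
  where
  x+c-c≡x : ∀ x → x + c + - c ≡ x
  x+c-c≡x x = trans (+-assoc x c (- c)) (trans (cong (x +_) (+-inverseʳ c)) (+-identityʳ x))

*-nonNeg : ∀ {a b} → 0ℚ ≤ a → 0ℚ ≤ b → 0ℚ ≤ a * b
*-nonNeg {a} {b} 0≤a 0≤b =
  nonNegative⁻¹ _ {{nonNeg*nonNeg⇒nonNeg a {{nonNegative 0≤a}} b {{nonNegative 0≤b}}}}

÷'-pos : ∀ a b .{{_ : Positive b}} → a ÷' b ≡ a * (1/ b) {{pos⇒nonZero b}}
÷'-pos a b with b ≟ 0ℚ
... | yes refl = contradiction (positive⁻¹ b) (<-irrefl refl)
... | no _     = refl

≤-*⇒÷'-≤ : ∀ {a b c} → 0ℚ < b → a ≤ c * b → a ÷' b ≤ c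
≤-*⇒÷'-≤ {a} {b} {c} 0<b a≤cb = begin
  a ÷' b             ≡⟨ ÷'-pos a b ⟩
  a * 1/ b           ≤⟨ *-monoʳ-≤-nonNeg (1/ b) {{pos⇒nonNeg (1/ b) {{1/pos⇒pos b}}}} a≤cb ⟩
  c * b * 1/ b       ≡⟨ *-assoc c b (1/ b) ⟩
  c * (b * 1/ b)     ≡⟨ cong (c *_) (*-inverseʳ b) ⟩
  c * 1ℚ             ≡⟨ *-identityʳ c ⟩
  c                  ∎
  where
  open ≤-Reasoning
  instance
    _ = positive 0<b
    _ = pos⇒nonZero b

÷'-≤⇒≤-* : ∀ {a b c} → 0ℚ < b → a ÷' b ≤ c → a ≤ c * b
÷'-≤⇒≤-* {a} {b} {c} 0<b a÷b≤c = begin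
  a                  ≡⟨ sym (*-identityʳ a) ⟩
  a * 1ℚ             ≡⟨ cong (a *_) (sym (*-inverseˡ b)) ⟩
  a * (1/ b * b)     ≡⟨ sym (*-assoc a (1/ b) b) ⟩
  a * 1/ b * b       ≡⟨ cong (_* b) (sym (÷'-pos a b)) ⟩
  a ÷' b * b         ≤⟨ *-monoʳ-≤-nonNeg b {{pos⇒nonNeg b}} a÷b≤c ⟩
  c * b              ∎
  where
  open ≤-Reasoning
  instance
    _ = positive 0<b
    _ = pos⇒nonZero b

÷'-nonNeg : ∀ {a b} → 0ℚ ≤ a → 0ℚ ≤ b → 0ℚ ≤ a ÷' b
÷'-nonNeg {a} {b} 0≤a 0≤b with b ≟ 0ℚ
... | yes _  = ≤-refl
... | no b≢0 with <-cmp 0ℚ b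
...   | tri< 0<b _ _ = *-nonNeg 0≤a (<⇒≤ (positive⁻¹ _ {{1/pos⇒pos b {{positive 0<b}}}}))
...   | tri≈ _ 0≡b _ = contradiction (sym 0≡b) b≢0
...   | tri> _ _ b<0 = contradiction (≤-<-trans 0≤b b<0) (<-irrefl refl)

-- ℕtoℚ k normalises k/1, which ↥p/↧p≡p identifies with the literal mkℚ k 0 _.
1≤ℕtoℚ-suc : ∀ k → 1ℚ ≤ ℕtoℚ (ℕ.suc k)
1≤ℕtoℚ-suc k rewrite ↥p/↧p≡p (mkℚ (ℤ.+ ℕ.suc k) 0 (Coprime.sym (Coprime.1-coprimeTo (ℕ.suc k)))) =
  *≤* (ℤ.+≤+ (ℕ.s≤s ℕ.z≤n))

cfac-pos : ∀ n → 0ℚ < cfac n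
cfac-pos n = <-≤-trans (positive⁻¹ 1ℚ) (+-monoʳ-≤ (1ℚ + 1ℚ) (neg-antimono-≤ (1/n≤1 n)))
  where
  1/n≤1 : ∀ n → 1ℚ ÷' ℕtoℚ n ≤ 1ℚ
  1/n≤1 ℕ.zero  = <⇒≤ (positive⁻¹ 1ℚ)   -- 1 ÷' 0 computes to the junk value 0
  1/n≤1 (ℕ.suc k) = ≤-*⇒÷'-≤ (<-≤-trans (positive⁻¹ 1ℚ) (1≤ℕtoℚ-suc k))
                     (subst (1ℚ ≤_) (sym (*-identityˡ _)) (1≤ℕtoℚ-suc k))

ΣOver : ∀ {k} → Subset k → (Fin k → ℚ) → ℚ
ΣOver A f = Σℚ (λ i → sel (lookup A i) (f i))

sel-* : ∀ s c q → sel s (c * q) ≡ c * sel s q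
sel-* inside  c q = refl
sel-* outside c q = sym (*-zeroʳ c)

sel+selOut : ∀ s q → sel s q + selOut s q ≡ q
sel+selOut inside  q = +-identityʳ q
sel+selOut outside q = +-identityˡ q

ΣOver-⊥ : ∀ {k} (f : Fin k → ℚ) → ΣOver ⊥ f ≡ 0ℚ
ΣOver-⊥ {ℕ.zero}  f = refl
ΣOver-⊥ {ℕ.suc k} f = trans (+-identityˡ _) (ΣOver-⊥ (f ∘ suc))

ΣOver-* : ∀ {k} (A : Subset k) c (f : Fin k → ℚ) → ΣOver A (λ i → c * f i) ≡ c * ΣOver A f
ΣOver-* []      c f = sym (*-zeroʳ c)
ΣOver-* (a ∷ A) c f = trans (cong₂ _+_ (sel-* a c (f zero)) (ΣOver-* A c (f ∘ suc)))
                            (sym (*-distribˡ-+ c _ _))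

ΣOver+ΣOut : ∀ {k} (A : Subset k) (f : Fin k → ℚ) →
             ΣOver A f + Σℚ (λ i → selOut (lookup A i) (f i)) ≡ Σℚ f
ΣOver+ΣOut []      f = refl
ΣOver+ΣOut (a ∷ A) f = trans (interchange (sel a (f zero)) (ΣOver A (f ∘ suc)) (selOut a (f zero)) _)
                             (cong₂ _+_ (sel+selOut a (f zero)) (ΣOver+ΣOut A (f ∘ suc)))

ΣOver-mono-⊆ : ∀ {k} {A B : Subset k} {f : Fin k → ℚ} →
               (∀ i → 0ℚ ≤ f i) → A ⊆ B → ΣOver A f ≤ ΣOver B f
ΣOver-mono-⊆ {A = []}          {[]}          f≥0 A⊆B = ≤-refl
ΣOver-mono-⊆ {A = outside ∷ A} {outside ∷ B} {f} f≥0 A⊆B =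
  +-monoʳ-≤ 0ℚ (ΣOver-mono-⊆ {f = f ∘ suc} (f≥0 ∘ suc) (drop-∷-⊆ A⊆B))
ΣOver-mono-⊆ {A = outside ∷ A} {inside ∷ B}  {f} f≥0 A⊆B =
  +-mono-≤ (f≥0 zero) (ΣOver-mono-⊆ {f = f ∘ suc} (f≥0 ∘ suc) (drop-∷-⊆ A⊆B))
ΣOver-mono-⊆ {A = inside ∷ A}  {inside ∷ B} {f} f≥0 A⊆B =
  +-monoʳ-≤ (f zero) (ΣOver-mono-⊆ {f = f ∘ suc} (f≥0 ∘ suc) (drop-∷-⊆ A⊆B))
ΣOver-mono-⊆ {A = inside ∷ A}  {outside ∷ B} f≥0 A⊆B with A⊆B here
... | ()

ΣOver-nonNeg : ∀ {k} (A : Subset k) {f : Fin k → ℚ} → (∀ i → 0ℚ ≤ f i) → 0ℚ ≤ ΣOver A f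
ΣOver-nonNeg A {f} f≥0 = subst (_≤ ΣOver A f) (ΣOver-⊥ f) (ΣOver-mono-⊆ {A = ⊥} {A} f≥0 ⊥⊆)

ΣOver-∪⁅⁆ : ∀ {k} {A : Subset k} {x} (f : Fin k → ℚ) → x ∉ A → ΣOver (A ∪ ⁅ x ⁆) f ≡ ΣOver A f + f x
ΣOver-∪⁅⁆ {A = inside ∷ A}  {zero}  f x∉A = contradiction here x∉A
ΣOver-∪⁅⁆ {A = outside ∷ A} {zero}  f x∉A rewrite ∪-identityʳ A =
  trans (+-comm (f zero) (ΣOver A (f ∘ suc))) (cong (_+ f zero) (sym (+-identityˡ (ΣOver A (f ∘ suc)))))
ΣOver-∪⁅⁆ {A = a ∷ A}       {suc x} f x∉A rewrite ∨-identityʳ a =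
  trans (cong (sel a (f zero) +_) (ΣOver-∪⁅⁆ (f ∘ suc) (x∉A ∘ there)))
        (sym (+-assoc (sel a (f zero)) (ΣOver A (f ∘ suc)) (f (suc x))))

ΣOver-⁅⁆ : ∀ {k} (x : Fin k) (f : Fin k → ℚ) → ΣOver ⁅ x ⁆ f ≡ f x
ΣOver-⁅⁆ x f = begin
  ΣOver ⁅ x ⁆ f        ≡⟨ cong (λ A → ΣOver A f) (sym (∪-identityˡ ⁅ x ⁆)) ⟩
  ΣOver (⊥ ∪ ⁅ x ⁆) f  ≡⟨ ΣOver-∪⁅⁆ f ∉⊥ ⟩
  ΣOver ⊥ f + f x      ≡⟨ cong (_+ f x) (ΣOver-⊥ f) ⟩
  0ℚ + f x             ≡⟨ +-identityˡ (f x) ⟩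
  f x                  ∎
  where open ≡-Reasoning

preimage : ∀ {k l} → (Fin k → Fin l) → Subset l → Subset k
preimage f S = tabulate (λ i → lookup S (f i))

∈-preimage⁺ : ∀ {k l} {f : Fin k → Fin l} {S i} → f i ∈ S → i ∈ preimage f S
∈-preimage⁺ {f = f} {S} {i} fi∈S =
  lookup⇒[]= i _ (trans (lookup∘tabulate (λ j → lookup S (f j)) i) ([]=⇒lookup fi∈S))

∈-preimage⁻ : ∀ {k l} {f : Fin k → Fin l} {S i} → i ∈ preimage f S → f i ∈ S
∈-preimage⁻ {f = f} {S} {i} i∈f⁻¹S =
  lookup⇒[]= (f i) S (trans (sym (lookup∘tabulate (λ j → lookup S (f j)) i)) ([]=⇒lookup i∈f⁻¹S))

module _ {N} (G : Graph N) where

  induced : Subset N → Subset (m G)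
  induced S = preimage (src G) S ∩ preimage (tgt G) S

  ∈-induced⁺ : ∀ {S e} → src G e ∈ S → tgt G e ∈ S → e ∈ induced S
  ∈-induced⁺ s∈S t∈S = x∈p∩q⁺ (∈-preimage⁺ s∈S , ∈-preimage⁺ t∈S)

  ∈-induced⁻ : ∀ {S e} → e ∈ induced S → src G e ∈ S × tgt G e ∈ S
  ∈-induced⁻ {S} e∈ with x∈p∩q⁻ (preimage (src G) S) _ e∈
  ... | s∈ , t∈ = ∈-preimage⁻ s∈ , ∈-preimage⁻ t∈

  induced-mono : ∀ {S S′} → S ⊆ S′ → induced S ⊆ induced S′
  induced-mono S⊆S′ e∈ with ∈-induced⁻ e∈
  ... | s∈ , t∈ = ∈-induced⁺ (S⊆S′ s∈) (S⊆S′ t∈)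

  Reach-closed : ∀ {E S u v} →
                 (∀ {e} → e ∈ E → src G e ∈ S → tgt G e ∈ S) →
                 (∀ {e} → e ∈ E → tgt G e ∈ S → src G e ∈ S) →
                 u ∈ S → Reach G E u v → v ∈ S
  Reach-closed fwd-closed bwd-closed u∈S here                = u∈S
  Reach-closed fwd-closed bwd-closed u∈S (fwd e e∈E u⇝src) =
    fwd-closed e∈E (Reach-closed fwd-closed bwd-closed u∈S u⇝src)
  Reach-closed fwd-closed bwd-closed u∈S (bwd e e∈E u⇝tgt) =
    bwd-closed e∈E (Reach-closed fwd-closed bwd-closed u∈S u⇝tgt)

p⊂p∪⁅x⁆ : ∀ {k} {p : Subset k} {x} → x ∉ p → p ⊂ p ∪ ⁅ x ⁆
p⊂p∪⁅x⁆ {p = p} {x} x∉p = p⊆p∪q ⁅ x ⁆ , x , q⊆p∪q p ⁅ x ⁆ (x∈⁅x⁆ x) , x∉p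

-- Grow a vertex set S from {r} inside T, one cut edge at a time; the vertex
-- added is charged to the edge through which it was reached.
module _ {N} {G : Graph N} {r : Fin N} (T : Tree G r) (p : Fin N → ℚ) (w : Fin (m G) → ℚ)
         (p≥0 : ∀ v → 0ℚ ≤ p v) (p-root : p r ≡ 0ℚ)
         (p-src≤w : ∀ e → p (src G e) ≤ w e) (p-tgt≤w : ∀ e → p (tgt G e) ≤ w e) where

  private
    w≥0 : ∀ e → 0ℚ ≤ w e
    w≥0 e = ≤-trans (p≥0 (src G e)) (p-src≤w e)

    Charged : Subset N → Set
    Charged S = ΣOver S p ≤ ΣOver (ET T ∩ induced G S) w

    CutEdge : Subset N → Fin (m G) → Set
    CutEdge S e = e ∈ ET T × (src G e ∈ S × tgt G e ∉ S ⊎ tgt G e ∈ S × src G e ∉ S)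

    cutEdge? : ∀ S e → Dec (CutEdge S e)
    cutEdge? S e = e ∈? ET T ×-dec ((src G e ∈? S ×-dec ¬? (tgt G e ∈? S))
                                    ⊎-dec (tgt G e ∈? S ×-dec ¬? (src G e ∈? S)))

    charged-root : Charged ⁅ r ⁆
    charged-root = begin
      ΣOver ⁅ r ⁆ p                     ≡⟨ trans (ΣOver-⁅⁆ r p) p-root ⟩
      0ℚ                                ≤⟨ ΣOver-nonNeg (ET T ∩ induced G ⁅ r ⁆) w≥0 ⟩
      ΣOver (ET T ∩ induced G ⁅ r ⁆) w  ∎
      where open ≤-Reasoning

    charged-extend : ∀ {S u e} → u ∉ S → e ∈ ET T → e ∈ induced G (S ∪ ⁅ u ⁆) → e ∉ induced G S →
                     p u ≤ w e → Charged S → Charged (S ∪ ⁅ u ⁆)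
    charged-extend {S} {u} {e} u∉S e∈T e∈S′ e∉S pu≤we charged = begin
      ΣOver (S ∪ ⁅ u ⁆) p  ≡⟨ ΣOver-∪⁅⁆ p u∉S ⟩
      ΣOver S p + p u      ≤⟨ +-mono-≤ charged pu≤we ⟩
      ΣOver I w + w e      ≡⟨ ΣOver-∪⁅⁆ w (e∉S ∘ p∩q⊆q (ET T) _) ⟨
      ΣOver (I ∪ ⁅ e ⁆) w  ≤⟨ ΣOver-mono-⊆ w≥0 I∪⁅e⁆⊆I′ ⟩
      ΣOver I′ w           ∎
      where
      open ≤-Reasoning
      I  = ET T ∩ induced G S
      I′ = ET T ∩ induced G (S ∪ ⁅ u ⁆)
      I∪⁅e⁆⊆I′ : I ∪ ⁅ e ⁆ ⊆ I′
      I∪⁅e⁆⊆I′ f∈ with x∈p∪q⁻ I ⁅ e ⁆ f∈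
      ... | inj₁ f∈I with x∈p∩q⁻ (ET T) _ f∈I
      ...   | f∈T , f∈S = x∈p∩q⁺ (f∈T , induced-mono G {S = S} (p⊆p∪q ⁅ u ⁆) f∈S)
      I∪⁅e⁆⊆I′ f∈ | inj₂ f∈⁅e⁆ rewrite x∈⁅y⁆⇒x≡y e f∈⁅e⁆ = x∈p∩q⁺ (e∈T , e∈S′)

    grow : ∀ S → Acc _⊃_ S → r ∈ S → Charged S → pT p T ≤ ℓT w T
    grow S (acc rec) r∈S charged with any? (cutEdge? S)
    ... | no noCut = begin
      pT p T                    ≤⟨ ΣOver-mono-⊆ p≥0 VT⊆S ⟩
      ΣOver S p                 ≤⟨ charged ⟩
      ΣOver (ET T ∩ induced G S) w ≤⟨ ΣOver-mono-⊆ w≥0 (p∩q⊆p (ET T) _) ⟩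
      ℓT w T                    ∎
      where
      open ≤-Reasoning
      VT⊆S : VT T ⊆ S
      VT⊆S v∈T = Reach-closed G
        (λ {e} e∈T s∈S → decidable-stable (tgt G e ∈? S) (λ t∉S → noCut (e , e∈T , inj₁ (s∈S , t∉S))))
        (λ {e} e∈T t∈S → decidable-stable (src G e ∈? S) (λ s∉S → noCut (e , e∈T , inj₂ (t∈S , s∉S))))
        r∈S (conn T _ v∈T)
    ... | yes (e , e∈T , inj₁ (s∈S , t∉S)) =
      grow (S ∪ ⁅ tgt G e ⁆) (rec (p⊂p∪⁅x⁆ t∉S)) (p⊆p∪q _ r∈S)
        (charged-extend t∉S e∈T
          (∈-induced⁺ G (p⊆p∪q _ s∈S) (q⊆p∪q S _ (x∈⁅x⁆ _)))
          (t∉S ∘ proj₂ ∘ ∈-induced⁻ G) (p-tgt≤w e) charged)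
    ... | yes (e , e∈T , inj₂ (t∈S , s∉S)) =
      grow (S ∪ ⁅ src G e ⁆) (rec (p⊂p∪⁅x⁆ s∉S)) (p⊆p∪q _ r∈S)
        (charged-extend s∉S e∈T
          (∈-induced⁺ G (q⊆p∪q S _ (x∈⁅x⁆ _)) (p⊆p∪q _ t∈S))
          (s∉S ∘ proj₁ ∘ ∈-induced⁻ G) (p-src≤w e) charged)

  pT≤ℓT : pT p T ≤ ℓT w T
  pT≤ℓT = grow ⁅ r ⁆ (⊃-wellFounded ⁅ r ⁆) (x∈⁅x⁆ r) charged-root

≤-foldr-⊔ : ∀ {A : Set} (f : A → ℚ) z {x} {xs : List A} → x ∈ₗ xs →
            f x ≤ foldr (λ y acc → f y ⊔ acc) z xs
≤-foldr-⊔ f z {xs = y ∷ xs} (here refl)  = p≤p⊔q (f y) _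
≤-foldr-⊔ f z {xs = y ∷ xs} (there x∈xs) = ≤-trans (≤-foldr-⊔ f z x∈xs) (p≤q⊔p (f y) _)

module _ {N} (G : Graph N) (r : Fin N) (p : Fin N → ℚ) (len : Fin (m G) → ℚ)
         (p≥0 : ∀ v → 0ℚ ≤ p v) (len>0 : ∀ e → 0ℚ < len e) where

  DensityBound : ℚ → Set
  DensityBound β = ∀ (T : Tree G r) → pT p T ≤ β * ℓT len T

  dens-nonNeg : ∀ (T : Tree G r) → 0ℚ ≤ dens p len T
  dens-nonNeg T = ÷'-nonNeg (ΣOver-nonNeg (VT T) p≥0) (ΣOver-nonNeg (ET T) (<⇒≤ ∘ len>0))

  betaInit-bound : p r ≡ 0ℚ → DensityBound (betaInit G p len)
  betaInit-bound p-root T = subst (pT p T ≤_) (ΣOver-* (ET T) β₀ len)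
    (pT≤ℓT T p (λ e → β₀ * len e) p≥0 p-root
      (λ e → ÷'-≤⇒≤-* (len>0 e) (≤-trans (p≤p⊔q _ _) (ratio≤β₀ e)))
      (λ e → ÷'-≤⇒≤-* (len>0 e) (≤-trans (p≤q⊔p (p (src G e) ÷' len e) _) (ratio≤β₀ e))))
    where
    β₀ = betaInit G p len
    ratio : Fin (m G) → ℚ
    ratio e = (p (src G e) ÷' len e) ⊔ (p (tgt G e) ÷' len e)
    ratio≤β₀ : ∀ e → ratio e ≤ β₀
    ratio≤β₀ e = ≤-foldr-⊔ ratio 0ℚ (∈-allFin e)

  module _ {n} {gw} (gw-approx : IsGW G r n gw) (Σp≡1 : Σℚ p ≡ 1ℚ) where

    private
      c = cfac n
      instance _ = positive (cfac-pos n)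

    gw-bound : ∀ ρ → 0ℚ ≤ ρ → let T₀ = gw (λ e → ρ * len e) p in
               c * pT p T₀ ≤ ρ * ℓT len T₀ → DensityBound ρ
    gw-bound ρ ρ≥0 certified T = *-cancelˡ-≤-pos c (+-cancelʳ-≤ (c * πOut p T) (begin
      c * pT p T + c * πOut p T       ≡⟨ trans (c*[pT+πOut]≡c T) (sym (c*[pT+πOut]≡c T₀)) ⟩
      c * pT p T₀ + c * πOut p T₀     ≤⟨ +-monoˡ-≤ (c * πOut p T₀) certified ⟩
      ρ * ℓT len T₀ + c * πOut p T₀   ≡⟨ cong (_+ c * πOut p T₀) (ΣOver-* (ET T₀) ρ len) ⟨
      ℓT ρλ T₀ + c * πOut p T₀        ≤⟨ gw-approx ρλ p (λ e → *-nonNeg ρ≥0 (<⇒≤ (len>0 e))) p≥0 T ⟩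
      c * (ℓT ρλ T + πOut p T)        ≡⟨ *-distribˡ-+ c _ _ ⟩
      c * ℓT ρλ T + c * πOut p T      ≡⟨ cong (λ x → c * x + c * πOut p T) (ΣOver-* (ET T) ρ len) ⟩
      c * (ρ * ℓT len T) + c * πOut p T ∎))
      where
      open ≤-Reasoning
      ρλ = λ e → ρ * len e
      T₀ = gw ρλ p
      c*[pT+πOut]≡c : ∀ T → c * pT p T + c * πOut p T ≡ c
      c*[pT+πOut]≡c T = begin-equality
        c * pT p T + c * πOut p T   ≡⟨ *-distribˡ-+ c _ _ ⟨
        c * (pT p T + πOut p T)     ≡⟨ cong (c *_) (trans (ΣOver+ΣOut (VT T) p) Σp≡1) ⟩
        c * 1ℚ                      ≡⟨ *-identityʳ c ⟩
        c                           ∎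

    run-bound : ∀ {ε α β Ts out} → 0ℚ ≤ ε → ParRun G r n p len gw ε α β Ts out →
                α ≡ c * dens p len Ts → DensityBound β →
                DensityBound ((1ℚ + ε) * c * dens p len out)
    run-bound {ε} {β = β} {Ts} ε≥0 (stop β≤) refl bound T = begin
      pT p T                           ≤⟨ bound T ⟩
      β * ℓT len T                     ≤⟨ *-monoʳ-≤-nonNeg (ℓT len T) {{ℓT≥0}} β≤ ⟩
      (1ℚ + ε) * (c * d) * ℓT len T    ≡⟨ cong (_* ℓT len T) (*-assoc (1ℚ + ε) c d) ⟨
      (1ℚ + ε) * c * d * ℓT len T      ∎
      where
      open ≤-Reasoning
      d = dens p len Ts
      ℓT≥0 = nonNegative (ΣOver-nonNeg (ET T) (<⇒≤ ∘ len>0))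
    run-bound {β = β} {Ts} ε≥0 (stepβ gap certified rest) refl bound =
      run-bound ε≥0 rest refl (gw-bound _ midpoint≥0 certified)
      where
      α≥0 : 0ℚ ≤ c * dens p len Ts
      α≥0 = *-nonNeg (<⇒≤ (cfac-pos n)) (dens-nonNeg Ts)
      β≥0 : 0ℚ ≤ β
      β≥0 = <⇒≤ (≤-<-trans (*-nonNeg (+-mono-≤ (<⇒≤ (positive⁻¹ 1ℚ)) ε≥0) α≥0) gap)
      midpoint≥0 : 0ℚ ≤ (c * dens p len Ts + β) ÷' (1ℚ + 1ℚ)
      midpoint≥0 = ÷'-nonNeg (+-mono-≤ α≥0 β≥0) (<⇒≤ (positive⁻¹ (1ℚ + 1ℚ)))
    run-bound ε≥0 (stepα _ _ rest) _ bound = run-bound ε≥0 rest refl bound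

proposition1 :
    ∀ {n : ℕ} (G : Graph (suc n)) (r : Fin (suc n)) → Connected G →
    (p : Fin (suc n) → ℚ) (len : Fin (m G) → ℚ) →
    (∀ v → 0ℚ ≤ p v) → (∀ v → p v ≤ 1ℚ) → p r ≡ 0ℚ → Σℚ p ≡ 1ℚ →
    (∀ e → 0ℚ < len e) →
    (gw : (Fin (m G) → ℚ) → (Fin (suc n) → ℚ) → Tree G r) → IsGW G r n gw →
    (ε : ℚ) → 0ℚ < ε →
    (Ts₀ : Tree G r) → 0ℚ < ℓT len Ts₀ →
    (Ts : Tree G r) →
    ParRun G r n p len gw ε (cfac n * dens p len Ts₀) (betaInit G p len) Ts₀ Ts →
    (T : Tree G r) → 0ℚ < ℓT len T →
    dens p len T ≤ ((1ℚ + ε) * cfac n) * dens p len Ts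
proposition1 {n} G r _ p len p≥0 _ p-root Σp≡1 len>0 gw gw-approx ε ε>0 _ _ Ts run T λT>0 =
  ≤-*⇒÷'-≤ λT>0 (final-bound T)
  where
  final-bound : DensityBound G r p len p≥0 len>0 ((1ℚ + ε) * cfac n * dens p len Ts)
  final-bound = run-bound G r p len p≥0 len>0 gw-approx Σp≡1 (<⇒≤ ε>0) run refl
                  (betaInit-bound G r p len p≥0 len>0 p-root)
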